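{- Let $d\ge3$, $h\ge1$, $1\le n\le h$, and let $j$ be a vertex at depth $n$ of $\mathcal{T}(d,h)$. Then the order of (the image of) $\bar{\mathbf{x}}_j$ in the quotient group $G(d,h)/G_{n-1}(d,h)$ is $\theta(d,h+2-n)$, where $\theta(d,m)=\frac{(d-1)^m-1}{d-2}$.
   Context: Let $\mathcal{T}(d,h)$ be the ball of radius $h$ about a root vertex $0$ in the infinite $d$-regular tree (root has $d$ children, vertices at depth $1,\dots,h-1$ have $d-1$ children, depth-$h$ vertices are leaves; depth is the distance from $0$). Let $V$ be its vertex set, $p(i)$ the parent of $i\neq 0$, $C_i$ the children of $i$, $\{\mathbf{x}_i\}$ the standard basis of $\mathbb{Z}^V$, and $\delta_i = d\mathbf{x}_i - \mathbf{x}_{p(i)} - \sum_{j\in C_i}\mathbf{x}_j$ (omit $\mathbf{x}_{p(i)}$ for $i=0$). The sandpile group is $G(d,h)=\mathbb{Z}^V/\sum_{i\in V}\mathbb{Z}\delta_i$, and $\bar{\mathbf{v}}$ denotes the image of $\mathbf{v}\in\mathbb{Z}^V$. For $0\le m\le h$, $G_m(d,h)$ denotes the subgroup of $G(d,h)$ generated by $\{\bar{\mathbf{x}}_i : i \text{ at depth}\le m\}$. -}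

module Defs where

open import Data.Nat using (ℕ; zero; suc; _∸_; _^_; _/_; _<ᵇ_; _≤_; _<_)
open import Data.Fin using (Fin)
import Data.Fin as F
open import Data.Bool using (Bool; true; false; _∧_; if_then_else_)
open import Data.Integer using (ℤ; +_; _+_; _-_; _*_)
open import Data.Product using (Σ; _×_; ∃)
open import Relation.Nullary using (¬_; does)
open import Relation.Binary.PropositionalEquality using (_≡_)

-- A vertex at depth 1 is a child  top a  of the
-- root (a : Fin d); a vertex at depth k+2 is  ext i v , the i-th child
-- (i : Fin (d-1)) of the vertex v at depth k+1.  The vertex set V of T(d,h)
-- consists of the vertices of depth k ≤ h.
data Vtx (d : ℕ) : ℕ → Set where
  root : Vtx d 0
  top  : Fin d → Vtx d 1
  ext  : ∀ {k} → Fin (d ∸ 1) → Vtx d (suc k) → Vtx d (suc (suc k))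

eqVtx : ∀ {d a b} → Vtx d a → Vtx d b → Bool
eqVtx root root = true
eqVtx (top a) (top b) = does (a F.≟ b)
eqVtx (ext i v) (ext i′ v′) = does (i F.≟ i′) ∧ eqVtx v v′
eqVtx _ _ = false

-- Elements of ℤ^V: integer coefficients on vertices (values at depth > h are
-- never used).
Config : ℕ → Set
Config d = (m : ℕ) → Vtx d m → ℤ

scaledBasis : ∀ {d n} → ℕ → Vtx d n → Config d
scaledBasis k j m u = if eqVtx j u then + k else + 0

sumFin : (n : ℕ) → (Fin n → ℤ) → ℤ
sumFin zero f = + 0
sumFin (suc n) f = f Fin.zero + sumFin n (λ i → f (Fin.suc i))

parentTerm : ∀ {d k} → Config d → Vtx d k → ℤ
parentTerm c root = + 0
parentTerm c (top a) = c 0 root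
parentTerm {k = suc (suc k)} c (ext i v) = c (suc k) v

-- sum of coefficients of the children of u (ignoring the depth bound h)
childSum : ∀ {d k} → Config d → Vtx d k → ℤ
childSum {d} c root = sumFin d (λ a → c 1 (top a))
childSum {d} {suc k} c v = sumFin (d ∸ 1) (λ i → c (suc (suc k)) (ext i v))

-- Coordinate u (at depth m ≤ h) of  Σ_i c_i δ_i  in ℤ^V for T(d,h):
--   d c_u - c_{p(u)} - Σ_{w ∈ C_u} c_w   (children only exist when m < h).
combDelta : (d h : ℕ) → Config d → Config d
combDelta d h c m u =
  (+ d * c m u - parentTerm c u) - (if m <ᵇ h then childSum c u else + 0)

-- The element represented by v lies in  G_{n-1}(d,h)  (inside G(d,h)), i.e.
-- v ∈ Σ_i ℤ δ_i + Σ_{depth(i) ≤ n-1} ℤ x_i  in ℤ^V.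
InSubgroupBelow : (d h n : ℕ) → Config d → Set
InSubgroupBelow d h n v =
  Σ (Config d) λ c → Σ (Config d) λ e →
    (∀ m (u : Vtx d m) → n ≤ m → e m u ≡ + 0) ×
    (∀ m → m ≤ h → (u : Vtx d m) → v m u ≡ combDelta d h c m u + e m u)

HasOrderInQuotient : (d h n : ℕ) → Vtx d n → ℕ → Set
HasOrderInQuotient d h n j t =
  (0 < t) ×
  InSubgroupBelow d h n (scaledBasis t j) ×
  (∀ k → 0 < k → k < t → ¬ InSubgroupBelow d h n (scaledBasis k j))

-- θ(d,m) = ((d-1)^m - 1)/(d-2)  (only used for d ≥ 3, where it is exact).
θ : ℕ → ℕ → ℕ
θ (suc (suc (suc e))) m = ((suc (suc e)) ^ m ∸ 1) / (suc e)
θ _ m = 0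

-- Write D = d - 1, H = h - n and R m = 1 + D + ... + D^(m-1), so that the claimed order is
-- R (H + 2).  The configuration equal to R (h + 1 - depth u) on the subtree rooted at j and to 0
-- elsewhere topples to R (H + 2) x_j at every depth ≥ n, because d R (s + 1) - R (s + 2) - D R s = 0
-- below j while d R (H + 1) - D R H = R (H + 2) at j; the vertices above depth n absorb the rest.
-- Conversely, if k x_j = Σ c_i δ_i modulo G_{n-1}, sum this relation over the descendants r levels
-- below j and below a sibling j′ of j (which exists as d ≥ 3), and subtract: the common parent
-- drops out, and the differences T r of the level sums of c satisfy k = d T 0 - T 1,
-- T (r + 2) = d T (r + 1) - D T r and T (H + 1) = 0.  Solving, R (H + 2) T 0 = R (H + 1) k,
-- hence k = R (H + 2) (k - D T 0) is a multiple of R (H + 2).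

module Submission where

open import Defs
open import Data.Nat using (ℕ; zero; suc; _+_; _∸_; _^_; _≤_; _<_; _<ᵇ_; _≤ᵇ_; z≤n; s≤s; >-nonZero)
import Data.Nat as ℕ
import Data.Nat.Properties as ℕ
open import Data.Nat.DivMod using (m*n/n≡m)
open import Data.Nat.Divisibility using (_∣_; >⇒∤)
import Data.Nat.Tactic.RingSolver as ℕ-Solver
open import Data.Fin using (Fin)
import Data.Fin as Fin
open import Data.Bool using (Bool; true; false; T; _∨_; if_then_else_)
open import Data.Bool.Properties using (¬-not; ∨-identityʳ)
open import Data.Integer using (ℤ; +_; -_; _-_; _*_) renaming (_+_ to _+ℤ_)
import Data.Integer.Properties as ℤ
open import Data.Integer.Divisibility.Signed using (divides; ∣⇒∣ᵤ)
open import Data.Integer.Tactic.RingSolver using (solve-∀)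
open import Data.Product using (_×_; _,_; proj₂)
open import Data.Sum using (inj₁; inj₂)
open import Function using (_∘_)
open import Relation.Nullary using (does; contradiction)
open import Relation.Nullary.Decidable using (dec-true)
open import Relation.Binary.PropositionalEquality

sumFin-cong : ∀ n {f g : Fin n → ℤ} → (∀ i → f i ≡ g i) → sumFin n f ≡ sumFin n g
sumFin-cong zero    f≗g = refl
sumFin-cong (suc n) f≗g = cong₂ _+ℤ_ (f≗g Fin.zero) (sumFin-cong n (f≗g ∘ Fin.suc))

sumFin-+ : ∀ n (f g : Fin n → ℤ) → sumFin n (λ i → f i +ℤ g i) ≡ sumFin n f +ℤ sumFin n g
sumFin-+ zero    f g = refl
sumFin-+ (suc n) f g
  rewrite sumFin-+ n (f ∘ Fin.suc) (g ∘ Fin.suc) = interchange (f Fin.zero) (g Fin.zero) _ _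
  where
  interchange : ∀ a b x y → (a +ℤ b) +ℤ (x +ℤ y) ≡ (a +ℤ x) +ℤ (b +ℤ y)
  interchange = solve-∀

sumFin-neg : ∀ n (f : Fin n → ℤ) → sumFin n (λ i → - f i) ≡ - sumFin n f
sumFin-neg zero    f = refl
sumFin-neg (suc n) f
  rewrite sumFin-neg n (f ∘ Fin.suc) = sym (ℤ.neg-distrib-+ (f Fin.zero) _)

sumFin-*ˡ : ∀ n z (f : Fin n → ℤ) → sumFin n (λ i → z * f i) ≡ z * sumFin n f
sumFin-*ˡ zero    z f = sym (ℤ.*-zeroʳ z)
sumFin-*ˡ (suc n) z f
  rewrite sumFin-*ˡ n z (f ∘ Fin.suc) = sym (ℤ.*-distribˡ-+ z (f Fin.zero) _)

sumFin-const : ∀ n x → sumFin n (λ _ → x) ≡ + n * x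
sumFin-const zero    x = sym (ℤ.*-zeroˡ x)
sumFin-const (suc n) x rewrite sumFin-const n x = sym (ℤ.suc-* (+ n) x)

eqVtx-refl : ∀ {d m} (u : Vtx d m) → eqVtx u u ≡ true
eqVtx-refl root      = refl
eqVtx-refl (top a)   = dec-true (a Fin.≟ a) refl
eqVtx-refl (ext i u) rewrite dec-true (i Fin.≟ i) refl = eqVtx-refl u

eqVtx⇒depth≡ : ∀ {d a b} (u : Vtx d a) (v : Vtx d b) → eqVtx u v ≡ true → a ≡ b
eqVtx⇒depth≡ root      root       _ = refl
eqVtx⇒depth≡ (top _)   (top _)    _ = refl
eqVtx⇒depth≡ (ext i u) (ext i′ v) p with does (i Fin.≟ i′)
... | true = cong (suc ∘ suc) (ℕ.suc-injective (eqVtx⇒depth≡ u v p))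
eqVtx⇒depth≡ root      (top _)    ()
eqVtx⇒depth≡ root      (ext _ _)  ()
eqVtx⇒depth≡ (top _)   root       ()
eqVtx⇒depth≡ (top _)   (ext _ _)  ()
eqVtx⇒depth≡ (ext _ _) root       ()
eqVtx⇒depth≡ (ext _ _) (top _)    ()

eqVtx-depth≢ : ∀ {d a b} (u : Vtx d a) (v : Vtx d b) → a ≢ b → eqVtx u v ≡ false
eqVtx-depth≢ u v a≢b = ¬-not (a≢b ∘ eqVtx⇒depth≡ u v)

scaledBasis-self : ∀ {d n} k (j : Vtx d n) → scaledBasis k j n j ≡ + k
scaledBasis-self k j rewrite eqVtx-refl j = refl

scaledBasis-depth≢ : ∀ {d n m} k (j : Vtx d n) (u : Vtx d m) → n ≢ m → scaledBasis k j m u ≡ + 0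
scaledBasis-depth≢ k j u n≢m rewrite eqVtx-depth≢ j u n≢m = refl

sibling : ∀ {e k} → Vtx (3 + e) (suc k) → Vtx (3 + e) (suc k)
sibling (top Fin.zero)     = top (Fin.suc Fin.zero)
sibling (top (Fin.suc _))  = top Fin.zero
sibling (ext Fin.zero v)    = ext (Fin.suc Fin.zero) v
sibling (ext (Fin.suc _) v) = ext Fin.zero v

eqVtx-sibling : ∀ {e k} (j : Vtx (3 + e) (suc k)) → eqVtx j (sibling j) ≡ false
eqVtx-sibling (top Fin.zero)      = refl
eqVtx-sibling (top (Fin.suc _))   = refl
eqVtx-sibling (ext Fin.zero _)    = refl
eqVtx-sibling (ext (Fin.suc _) _) = refl

parentTerm-sibling : ∀ {e k} (c : Config (3 + e)) (j : Vtx (3 + e) (suc k)) →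
                     parentTerm c (sibling j) ≡ parentTerm c j
parentTerm-sibling c (top Fin.zero)      = refl
parentTerm-sibling c (top (Fin.suc _))   = refl
parentTerm-sibling c (ext Fin.zero _)    = refl
parentTerm-sibling c (ext (Fin.suc _) _) = refl

levelSum : ∀ {d k} → ℕ → Vtx d (suc k) → Config d → ℤ
levelSum         zero    v g = g _ v
levelSum {d = d} (suc r) v g = sumFin (d ∸ 1) λ i → levelSum r (ext i v) g

module _ {d : ℕ} where

  -- The depth is pinned by an equation so that the hypothesis passes down the recursion of
  -- levelSum, where it changes from suc r + suc k to r + suc (suc k), without transport.
  LevelAgree : ℕ → ℕ → Config d → Config d → Set
  LevelAgree r k f g = ∀ m → m ≡ r + suc k → (u : Vtx d m) → f m u ≡ g m u

  levelSum-cong : ∀ r {k} (v : Vtx d (suc k)) {f g} → LevelAgree r k f g →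
                  levelSum r v f ≡ levelSum r v g
  levelSum-cong zero    v f≈g = f≈g _ refl v
  levelSum-cong (suc r) {k} v f≈g = sumFin-cong (d ∸ 1) λ i →
    levelSum-cong r (ext i v) λ m m≡ → f≈g m (trans m≡ (ℕ.+-suc r (suc k)))

  levelSum-+ : ∀ r {k} (v : Vtx d (suc k)) f g →
               levelSum r v (λ m u → f m u +ℤ g m u) ≡ levelSum r v f +ℤ levelSum r v g
  levelSum-+ zero    v f g = refl
  levelSum-+ (suc r) v f g = trans (sumFin-cong (d ∸ 1) λ i → levelSum-+ r (ext i v) f g)
                                   (sumFin-+ (d ∸ 1) _ _)

  levelSum-neg : ∀ r {k} (v : Vtx d (suc k)) f →
                 levelSum r v (λ m u → - f m u) ≡ - levelSum r v f
  levelSum-neg zero    v f = refl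
  levelSum-neg (suc r) v f = trans (sumFin-cong (d ∸ 1) λ i → levelSum-neg r (ext i v) f)
                                   (sumFin-neg (d ∸ 1) _)

  levelSum-*ˡ : ∀ r {k} (v : Vtx d (suc k)) z f →
                levelSum r v (λ m u → z * f m u) ≡ z * levelSum r v f
  levelSum-*ˡ zero    v z f = refl
  levelSum-*ˡ (suc r) v z f = trans (sumFin-cong (d ∸ 1) λ i → levelSum-*ˡ r (ext i v) z f)
                                    (sumFin-*ˡ (d ∸ 1) z _)

  levelSum-zero : ∀ r {k} (v : Vtx d (suc k)) → levelSum r v (λ _ _ → + 0) ≡ + 0
  levelSum-zero zero    v = refl
  levelSum-zero (suc r) v = begin
    sumFin (d ∸ 1) (λ i → levelSum r (ext i v) (λ _ _ → + 0)) ≡⟨ sumFin-cong (d ∸ 1) (λ i → levelSum-zero r (ext i v)) ⟩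
    sumFin (d ∸ 1) (λ _ → + 0)                                 ≡⟨ sumFin-const (d ∸ 1) (+ 0) ⟩
    + (d ∸ 1) * + 0                                            ≡⟨ ℤ.*-zeroʳ (+ (d ∸ 1)) ⟩
    + 0                                                        ∎
    where open ≡-Reasoning

  levelSum-vanishing : ∀ r {k} (v : Vtx d (suc k)) f → LevelAgree r k f (λ _ _ → + 0) →
                       levelSum r v f ≡ + 0
  levelSum-vanishing r v f f≈0 = trans (levelSum-cong r v f≈0) (levelSum-zero r v)

  levelSum-if : ∀ r {k} (v : Vtx d (suc k)) h f →
                levelSum r v (λ m u → if m <ᵇ h then f m u else + 0) ≡
                (if r + suc k <ᵇ h then levelSum r v f else + 0)
  levelSum-if r {k} v h f with r + suc k <ᵇ h in test
  ... | true  = levelSum-cong r v λ where m refl u → cong (λ b → if b then f m u else + 0) test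
  ... | false = levelSum-vanishing r v _ λ where m refl u → cong (λ b → if b then f m u else + 0) test

  levelSum-parentTerm : ∀ r {k} (v : Vtx d (suc k)) c →
                        levelSum (suc r) v (λ _ u → parentTerm c u) ≡ + (d ∸ 1) * levelSum r v c
  levelSum-parentTerm zero    v c = sumFin-const (d ∸ 1) _
  levelSum-parentTerm (suc r) v c =
    trans (sumFin-cong (d ∸ 1) λ i → levelSum-parentTerm r (ext i v) c)
          (sumFin-*ˡ (d ∸ 1) (+ (d ∸ 1)) _)

  levelSum-childSum : ∀ r {k} (v : Vtx d (suc k)) c →
                      levelSum r v (λ _ u → childSum c u) ≡ levelSum (suc r) v c
  levelSum-childSum zero    (top _)   c = refl
  levelSum-childSum zero    (ext _ _) c = refl
  levelSum-childSum (suc r) v         c = sumFin-cong (d ∸ 1) λ i → levelSum-childSum r (ext i v) c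

  levelSum-combDelta : ∀ r {k} (v : Vtx d (suc k)) h c →
    levelSum r v (combDelta d h c) ≡
    (+ d * levelSum r v c - levelSum r v (λ _ u → parentTerm c u))
      - (if r + suc k <ᵇ h then levelSum (suc r) v c else + 0)
  levelSum-combDelta r {k} v h c = begin
    levelSum r v (combDelta d h c)
      ≡⟨ levelSum-+ r v _ _ ⟩
    levelSum r v (λ m u → + d * c m u - parentTerm c u) +ℤ
      levelSum r v (λ m u → - (if m <ᵇ h then childSum c u else + 0))
      ≡⟨ cong₂ _+ℤ_ (trans (levelSum-+ r v _ _) (cong₂ _+ℤ_ (levelSum-*ˡ r v (+ d) c) (levelSum-neg r v _)))
                    (levelSum-neg r v _) ⟩
    (+ d * levelSum r v c - levelSum r v (λ _ u → parentTerm c u)) -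
      levelSum r v (λ m u → if m <ᵇ h then childSum c u else + 0)
      ≡⟨ cong (λ x → (+ d * levelSum r v c - levelSum r v (λ _ u → parentTerm c u)) - x)
              (trans (levelSum-if r v h _) (cong (λ x → if r + suc k <ᵇ h then x else + 0) (levelSum-childSum r v c))) ⟩
    (+ d * levelSum r v c - levelSum r v (λ _ u → parentTerm c u))
      - (if r + suc k <ᵇ h then levelSum (suc r) v c else + 0) ∎
    where open ≡-Reasoning

repunit : ℕ → ℕ → ℕ
repunit b zero    = 0
repunit b (suc m) = b ℕ.* repunit b m + 1

^≡1+repunit* : ∀ e m → (2 + e) ^ m ≡ 1 + repunit (2 + e) m ℕ.* (1 + e)
^≡1+repunit* e zero    = refl
^≡1+repunit* e (suc m) rewrite ^≡1+repunit* e m = distrib e (repunit (2 + e) m)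
  where
  distrib : ∀ e x → (2 + e) ℕ.* (1 + x ℕ.* (1 + e)) ≡ 1 + ((2 + e) ℕ.* x + 1) ℕ.* (1 + e)
  distrib = ℕ-Solver.solve-∀

θ≡repunit : ∀ e m → θ (3 + e) m ≡ repunit (2 + e) m
θ≡repunit e m rewrite ^≡1+repunit* e m = m*n/n≡m (repunit (2 + e) m) (1 + e)

+repunit-suc : ∀ b m → + repunit b (suc m) ≡ + b * + repunit b m +ℤ + 1
+repunit-suc b m = trans (ℤ.pos-+ (b ℕ.* repunit b m) 1) (cong (_+ℤ + 1) (ℤ.pos-* b (repunit b m)))

repunit-recurrence : ∀ b m →
  + repunit b (2 + m) ≡ + (1 + b) * + repunit b (1 + m) - + b * + repunit b m
repunit-recurrence b m = begin
  + repunit b (2 + m)                     ≡⟨ +repunit-suc b (1 + m) ⟩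
  + b * y +ℤ + 1                          ≡⟨ step (+ b) x y (+repunit-suc b m) ⟩
  (+ 1 +ℤ + b) * y - + b * x              ≡⟨ cong (λ z → z * y - + b * x) (ℤ.pos-+ 1 b) ⟨
  + (1 + b) * y - + b * x                 ∎
  where
  open ≡-Reasoning
  x y : ℤ
  x = + repunit b m
  y = + repunit b (1 + m)
  step : ∀ b x y → y ≡ b * x +ℤ + 1 → b * y +ℤ + 1 ≡ (+ 1 +ℤ b) * y - b * x
  step b x _ refl = identity b x
    where
    identity : ∀ b x → b * (b * x +ℤ + 1) +ℤ + 1 ≡ (+ 1 +ℤ b) * (b * x +ℤ + 1) - b * x
    identity = solve-∀

repunit-one : ∀ b → repunit b 1 ≡ 1
repunit-one b = cong (_+ 1) (ℕ.*-zeroʳ b)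

repunit-suc-positive : ∀ b m → 0 < repunit b (suc m)
repunit-suc-positive b m = ℕ.m≤n+m 1 (b ℕ.* repunit b m)

θ-at-depth : ∀ e {h n} → n ≤ h → θ (3 + e) (h + 2 ∸ n) ≡ repunit (2 + e) (2 + (h ∸ n))
θ-at-depth e {h} {n} n≤h = trans (θ≡repunit e (h + 2 ∸ n))
  (cong (repunit (2 + e)) (trans (ℕ.+-∸-comm 2 n≤h) (ℕ.+-comm (h ∸ n) 2)))

solution-of-recurrence :
  ∀ b H k (T : ℕ → ℤ) →
  k ≡ + (1 + b) * T 0 - T 1 →
  (∀ r → r < H → + 0 ≡ + (1 + b) * T (1 + r) - + b * T r - T (2 + r)) →
  T (1 + H) ≡ + 0 →
  k ≡ + repunit b (2 + H) * (k - + b * T 0)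
solution-of-recurrence b H k T initial step terminal =
  conclude (+repunit-suc b (1 + H)) (trans (sym terminal) (proj₂ (T≡closed H ℕ.≤-refl)))
  where
  R : ℕ → ℤ
  R m = + repunit b m

  closed : ℕ → ℤ
  closed r = R (1 + r) * T 0 - R r * k

  closed-recurrence : ∀ r → closed (2 + r) ≡ + (1 + b) * closed (1 + r) - + b * closed r
  closed-recurrence r =
    trans (cong₂ (λ p q → p * T 0 - q * k) (repunit-recurrence b (1 + r)) (repunit-recurrence b r))
          (regroup (+ (1 + b)) (+ b) (R r) (R (1 + r)) (R (2 + r)) (T 0) k)
    where
    regroup : ∀ c b x y z t k →
      (c * z - b * y) * t - (c * y - b * x) * k ≡ c * (z * t - y * k) - b * (y * t - x * k)
    regroup = solve-∀

  R₁≡1 : R 1 ≡ + 1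
  R₁≡1 = cong +_ (repunit-one b)

  closed-0 : T 0 ≡ closed 0
  closed-0 = begin
    T 0                    ≡⟨ identity (T 0) k ⟩
    + 1 * T 0 - + 0 * k    ≡⟨ cong (λ p → p * T 0 - + 0 * k) R₁≡1 ⟨
    closed 0               ∎
    where
    open ≡-Reasoning
    identity : ∀ t k → t ≡ + 1 * t - + 0 * k
    identity = solve-∀

  closed-1 : T 1 ≡ closed 1
  closed-1 = begin
    T 1                                                  ≡⟨ isolate (+ (1 + b) * T 0) initial ⟩
    + (1 + b) * T 0 - k                                  ≡⟨ identity (+ (1 + b)) (+ b) (T 0) k ⟩
    (+ (1 + b) * + 1 - + b * + 0) * T 0 - + 1 * k        ≡⟨ cong₂ (λ p q → p * T 0 - q * k) R₂≡ R₁≡1 ⟨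
    closed 1                                             ∎
    where
    open ≡-Reasoning
    isolate : ∀ a {x y} → x ≡ a - y → y ≡ a - x
    isolate a {y = y} refl = identity a y
      where
      identity : ∀ a y → y ≡ a - (a - y)
      identity = solve-∀
    identity : ∀ c b t k → c * t - k ≡ (c * + 1 - b * + 0) * t - + 1 * k
    identity = solve-∀
    R₂≡ : R 2 ≡ + (1 + b) * + 1 - + b * + 0
    R₂≡ = trans (repunit-recurrence b 0) (cong (λ x → + (1 + b) * x - + b * + 0) R₁≡1)

  T≡closed : ∀ r → r ≤ H → T r ≡ closed r × T (1 + r) ≡ closed (1 + r)
  T≡closed zero    _   = closed-0 , closed-1
  T≡closed (suc r) r<H with T≡closed r (ℕ.<⇒≤ r<H)
  ... | Tr≡ , T1+r≡ = T1+r≡ , (begin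
    T (2 + r)                                  ≡⟨ sym (ℤ.i-j≡0⇒i≡j _ _ (sym (step r r<H))) ⟩
    + (1 + b) * T (1 + r) - + b * T r          ≡⟨ cong₂ (λ x y → + (1 + b) * x - + b * y) T1+r≡ Tr≡ ⟩
    + (1 + b) * closed (1 + r) - + b * closed r ≡⟨ sym (closed-recurrence r) ⟩
    closed (2 + r)                             ∎)
    where open ≡-Reasoning

  conclude : ∀ {r₁ r₂} → r₂ ≡ + b * r₁ +ℤ + 1 → + 0 ≡ r₂ * T 0 - r₁ * k → k ≡ r₂ * (k - + b * T 0)
  conclude {r₁} {r₂} refl balance = begin
    k                                                   ≡⟨ identity (+ b) r₁ k (T 0) ⟩
    r₂ * (k - + b * T 0) +ℤ + b * (r₂ * T 0 - r₁ * k)   ≡⟨ cong (λ z → r₂ * (k - + b * T 0) +ℤ + b * z) balance ⟨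
    r₂ * (k - + b * T 0) +ℤ + b * + 0                   ≡⟨ cong (r₂ * (k - + b * T 0) +ℤ_) (ℤ.*-zeroʳ (+ b)) ⟩
    r₂ * (k - + b * T 0) +ℤ + 0                         ≡⟨ ℤ.+-identityʳ _ ⟩
    r₂ * (k - + b * T 0)                                ∎
    where
    open ≡-Reasoning
    identity : ∀ b r k t → k ≡ (b * r +ℤ + 1) * (k - b * t) +ℤ b * ((b * r +ℤ + 1) * t - r * k)
    identity = solve-∀

<ᵇ-∸ : ∀ r {n h} → n ≤ h → (r + n <ᵇ h) ≡ (r <ᵇ h ∸ n)
<ᵇ-∸ r {h = h}         z≤n       = cong (_<ᵇ h) (ℕ.+-identityʳ r)
<ᵇ-∸ r {suc n} {suc h} (s≤s n≤h) = trans (cong (_<ᵇ suc h) (ℕ.+-suc r n)) (<ᵇ-∸ r n≤h)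

∸≡suc∸suc : ∀ {m h} → suc m ≤ h → h ∸ m ≡ suc (h ∸ suc m)
∸≡suc∸suc = ℕ.+-∸-assoc 1

InSubgroupBelow-intro : ∀ {d} h n (v c : Config d) →
  (∀ m → n ≤ m → m ≤ h → (u : Vtx d m) → v m u ≡ combDelta d h c m u) →
  InSubgroupBelow d h n v
InSubgroupBelow-intro {d} h n v c balanced = c , err , err-vanishes , balance
  where
  err : Config d
  err m u = if m <ᵇ n then v m u - combDelta d h c m u else + 0

  err-vanishes : ∀ m (u : Vtx d m) → n ≤ m → err m u ≡ + 0
  err-vanishes m u n≤m with m <ᵇ n | ℕ.<ᵇ⇒< m n
  ... | false | _   = refl
  ... | true  | m<n = contradiction (m<n _) (ℕ.≤⇒≯ n≤m)

  balance : ∀ m → m ≤ h → (u : Vtx d m) → v m u ≡ combDelta d h c m u +ℤ err m u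
  balance m m≤h u with m <ᵇ n in test
  ... | true  = identity (v m u) (combDelta d h c m u)
    where
    identity : ∀ x y → x ≡ y +ℤ (x - y)
    identity = solve-∀
  ... | false = trans (balanced m (ℕ.≮⇒≥ (λ m<n → subst T test (ℕ.<⇒<ᵇ m<n))) m≤h u)
                      (sym (ℤ.+-identityʳ _))

HasOrderInQuotient-intro : ∀ {d h n} {j : Vtx d n} {t} → 0 < t →
  InSubgroupBelow d h n (scaledBasis t j) →
  (∀ k → InSubgroupBelow d h n (scaledBasis k j) → t ∣ k) →
  HasOrderInQuotient d h n j t
HasOrderInQuotient-intro 0<t t∈G order-divides =
  0<t , t∈G , λ k 0<k k<t k∈G → >⇒∤ {{>-nonZero 0<k}} k<t (order-divides k k∈G)

mask : Bool → ℤ → ℤ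
mask b x = if b then x else + 0

module UpperBound (e : ℕ) {h n′ : ℕ} (j : Vtx (3 + e) (suc n′)) (n≤h : suc n′ ≤ h) where

  private
    d D H : ℕ
    d = 3 + e
    D = 2 + e
    H = h ∸ suc n′

    R : ℕ → ℤ
    R m = + repunit D m

  inSubtree : ∀ {m} → Vtx d m → Bool
  inSubtree root      = false
  inSubtree (top a)   = eqVtx j (top a)
  inSubtree (ext i v) = eqVtx j (ext i v) ∨ inSubtree v

  potential : Config d
  potential m u = mask (inSubtree u) (R (suc h ∸ m))

  inSubtree-shallow : ∀ {m} (u : Vtx d m) → m < suc n′ → inSubtree u ≡ false
  inSubtree-shallow root      _   = refl
  inSubtree-shallow (top a)   m<n = eqVtx-depth≢ j (top a) (λ n≡m → ℕ.<-irrefl (sym n≡m) m<n)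
  inSubtree-shallow (ext i v) m<n
    rewrite eqVtx-depth≢ j (ext i v) (λ n≡m → ℕ.<-irrefl (sym n≡m) m<n) =
    inSubtree-shallow v (ℕ.<-trans (ℕ.n<1+n _) m<n)

  inSubtree-top : ∀ (u : Vtx d (suc n′)) → inSubtree u ≡ eqVtx j u
  inSubtree-top (top a)   = refl
  inSubtree-top (ext i v) rewrite inSubtree-shallow v (ℕ.n<1+n _) = ∨-identityʳ _

  inSubtree-ext : ∀ {k} (v : Vtx d (suc k)) i → suc n′ ≤ suc k → inSubtree (ext i v) ≡ inSubtree v
  inSubtree-ext v i n≤k rewrite eqVtx-depth≢ j (ext i v) (λ n≡k → ℕ.<-irrefl n≡k (s≤s n≤k)) = refl

  children-term : ∀ {k} (u : Vtx d (suc k)) → suc n′ ≤ suc k → suc k ≤ h →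
    (if suc k <ᵇ h then childSum potential u else + 0) ≡ + D * mask (inSubtree u) (R (h ∸ suc k))
  children-term {k} u n≤k k≤h with suc k <ᵇ h in test
  ... | true = begin
    childSum potential u                                  ≡⟨ childSum-shape u ⟩
    sumFin D (λ i → potential (2 + k) (ext i u))          ≡⟨ sumFin-cong D (λ i → cong (λ b → mask b (R (h ∸ suc k))) (inSubtree-ext u i n≤k)) ⟩
    sumFin D (λ _ → mask (inSubtree u) (R (h ∸ suc k)))   ≡⟨ sumFin-const D _ ⟩
    + D * mask (inSubtree u) (R (h ∸ suc k))              ∎
    where
    open ≡-Reasoning
    childSum-shape : ∀ (u : Vtx d (suc k)) → childSum potential u ≡ sumFin D (λ i → potential (2 + k) (ext i u))
    childSum-shape (top _)   = refl
    childSum-shape (ext _ _) = refl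
  ... | false with ℕ.m≤n⇒m<n∨m≡n k≤h
  ...   | inj₁ k<h  = contradiction (ℕ.<⇒<ᵇ k<h) (subst T test)
  ...   | inj₂ refl rewrite ℕ.n∸n≡0 (suc k) = sym (trans (cong (+ D *_) (mask-zero (inSubtree u))) (ℤ.*-zeroʳ (+ D)))
    where
    mask-zero : ∀ b → mask b (+ 0) ≡ + 0
    mask-zero true  = refl
    mask-zero false = refl

  parent-outside : ∀ (u : Vtx d (suc n′)) → parentTerm potential u ≡ + 0
  parent-outside (top _)   = refl
  parent-outside (ext _ v) = cong (λ b → mask b _) (inSubtree-shallow v (ℕ.n<1+n _))

  mask-balance-top : ∀ b s → mask b (R (2 + s)) ≡ (+ d * mask b (R (1 + s)) - + 0) - + D * mask b (R s)
  mask-balance-top true  s = trans (repunit-recurrence D s) (identity (+ d) (+ D) (R (1 + s)) (R s))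
    where
    identity : ∀ a b y x → a * y - b * x ≡ (a * y - + 0) - b * x
    identity = solve-∀
  mask-balance-top false s = identity (+ d) (+ D)
    where
    identity : ∀ a b → + 0 ≡ (a * + 0 - + 0) - b * + 0
    identity = solve-∀

  mask-balance-inner : ∀ b s → + 0 ≡ (+ d * mask b (R (1 + s)) - mask b (R (2 + s))) - + D * mask b (R s)
  mask-balance-inner true  s = cancel {+ d} {R (1 + s)} {+ D} {R s} (repunit-recurrence D s)
    where
    cancel : ∀ {a y b x z} → z ≡ a * y - b * x → + 0 ≡ (a * y - z) - b * x
    cancel {a} {y} {b} {x} refl = identity a y b x
      where
      identity : ∀ a y b x → + 0 ≡ (a * y - (a * y - b * x)) - b * x
      identity = solve-∀
  mask-balance-inner false s = identity (+ d) (+ D)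
    where
    identity : ∀ a b → + 0 ≡ (a * + 0 - + 0) - b * + 0
    identity = solve-∀

  balanced-top : ∀ (u : Vtx d (suc n′)) →
    scaledBasis (repunit D (2 + H)) j (suc n′) u ≡ combDelta d h potential (suc n′) u
  balanced-top u = begin
    mask (eqVtx j u) (R (2 + H))
      ≡⟨ mask-balance-top (eqVtx j u) H ⟩
    (+ d * mask (eqVtx j u) (R (1 + H)) - + 0) - + D * mask (eqVtx j u) (R H)
      ≡⟨ cong₂ _-_ (cong₂ _-_ (cong (λ b → + d * mask b (R (1 + H))) (inSubtree-top u)) (parent-outside u))
                   (trans (children-term u ℕ.≤-refl n≤h) (cong (λ b → + D * mask b (R H)) (inSubtree-top u))) ⟨
    (+ d * mask (inSubtree u) (R (1 + H)) - parentTerm potential u)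
      - (if suc n′ <ᵇ h then childSum potential u else + 0)
      ≡⟨ cong (λ x → (+ d * mask (inSubtree u) (R x) - parentTerm potential u)
                       - (if suc n′ <ᵇ h then childSum potential u else + 0)) (∸≡suc∸suc n≤h) ⟨
    combDelta d h potential (suc n′) u
      ∎
    where open ≡-Reasoning

  balanced-inner : ∀ {k} (v : Vtx d (suc k)) i → suc n′ ≤ suc k → 2 + k ≤ h →
    scaledBasis (repunit D (2 + H)) j (2 + k) (ext i v) ≡ combDelta d h potential (2 + k) (ext i v)
  balanced-inner {k} v i n≤k k<h = begin
    scaledBasis (repunit D (2 + H)) j (2 + k) (ext i v)
      ≡⟨ scaledBasis-depth≢ _ j (ext i v) (λ n≡k → ℕ.<-irrefl n≡k (s≤s n≤k)) ⟩
    + 0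
      ≡⟨ mask-balance-inner b s ⟩
    (+ d * mask b (R (1 + s)) - mask b (R (2 + s))) - + D * mask b (R s)
      ≡⟨ cong₂ _-_ (cong₂ _-_ (cong (λ x → + d * mask x (R (1 + s))) (inSubtree-ext v i n≤k))
                              (cong (λ x → mask b (R x)) (trans (∸≡suc∸suc (ℕ.<⇒≤ k<h)) (cong suc (∸≡suc∸suc k<h)))))
                   (trans (children-term (ext i v) (ℕ.m≤n⇒m≤1+n n≤k) k<h)
                          (cong (λ x → + D * mask x (R s)) (inSubtree-ext v i n≤k))) ⟨
    (+ d * mask (inSubtree (ext i v)) (R (1 + s)) - mask b (R (h ∸ k)))
      - (if 2 + k <ᵇ h then childSum potential (ext i v) else + 0)
      ≡⟨ cong (λ x → (+ d * mask (inSubtree (ext i v)) (R x) - mask b (R (h ∸ k)))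
                       - (if 2 + k <ᵇ h then childSum potential (ext i v) else + 0)) (∸≡suc∸suc k<h) ⟨
    combDelta d h potential (2 + k) (ext i v)
      ∎
    where
    open ≡-Reasoning
    b : Bool
    b = inSubtree v
    s : ℕ
    s = h ∸ (2 + k)

  balanced : ∀ m → suc n′ ≤ m → m ≤ h → (u : Vtx d m) →
    scaledBasis (repunit D (2 + H)) j m u ≡ combDelta d h potential m u
  balanced _ (s≤s z≤n) _ (top a) = balanced-top (top a)
  balanced (suc (suc k)) n≤m m≤h (ext i v) with ℕ.m≤n⇒m<n∨m≡n n≤m
  ... | inj₂ refl      = balanced-top (ext i v)
  ... | inj₁ (s≤s n≤k) = balanced-inner v i n≤k m≤h

  multiple-in-subgroup : InSubgroupBelow d h (suc n′) (scaledBasis (repunit D (2 + H)) j)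
  multiple-in-subgroup = InSubgroupBelow-intro h (suc n′) _ potential balanced

module LowerBound (e : ℕ) {h n′ : ℕ} (j : Vtx (3 + e) (suc n′)) (n≤h : suc n′ ≤ h) (k : ℕ)
  (c err : Config (3 + e)) (err-vanishes : ∀ m (u : Vtx (3 + e) m) → suc n′ ≤ m → err m u ≡ + 0)
  (balance : ∀ m → m ≤ h → (u : Vtx (3 + e) m) → scaledBasis k j m u ≡ combDelta (3 + e) h c m u +ℤ err m u)
  where

  private
    d D H : ℕ
    d = 3 + e
    D = 2 + e
    H = h ∸ suc n′

  -- Cut off past the leaves: combDelta has no children term at depth h, which the recurrence
  -- sees as the boundary value A x (1 + H) = 0.
  A : Vtx d (suc n′) → ℕ → ℤ
  A x r = if r ≤ᵇ H then levelSum r x c else + 0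

  A-below : ∀ x {r} → r ≤ H → A x r ≡ levelSum r x c
  A-below x {r} r≤H with r ≤ᵇ H | ℕ.≤⇒≤ᵇ r≤H
  ... | true | _ = refl

  A-beyond : ∀ x → A x (1 + H) ≡ + 0
  A-beyond x with H <ᵇ H | ℕ.<ᵇ⇒< H H
  ... | false | _   = refl
  ... | true  | H<H = contradiction (H<H _) (ℕ.<-irrefl refl)

  level-balance : ∀ x r → r ≤ H →
    levelSum r x (scaledBasis k j) ≡ (+ d * A x r - levelSum r x (λ _ u → parentTerm c u)) - A x (1 + r)
  level-balance x r r≤H = begin
    levelSum r x (scaledBasis k j)
      ≡⟨ levelSum-cong r x (λ where m refl u → balance m (ℕ.m≤o∸n⇒m+n≤o r n≤h r≤H) u) ⟩
    levelSum r x (λ m u → combDelta d h c m u +ℤ err m u)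
      ≡⟨ levelSum-+ r x _ _ ⟩
    levelSum r x (combDelta d h c) +ℤ levelSum r x err
      ≡⟨ cong (levelSum r x (combDelta d h c) +ℤ_)
              (levelSum-vanishing r x err λ where m refl u → err-vanishes m u (ℕ.m≤n+m (suc n′) r)) ⟩
    levelSum r x (combDelta d h c) +ℤ + 0
      ≡⟨ ℤ.+-identityʳ _ ⟩
    levelSum r x (combDelta d h c)
      ≡⟨ levelSum-combDelta r x h c ⟩
    (+ d * levelSum r x c - levelSum r x (λ _ u → parentTerm c u))
      - (if r + suc n′ <ᵇ h then levelSum (1 + r) x c else + 0)
      ≡⟨ cong₂ (λ a b → (+ d * a - levelSum r x (λ _ u → parentTerm c u)) - (if b then levelSum (1 + r) x c else + 0))
               (sym (A-below x r≤H)) (<ᵇ-∸ r n≤h) ⟩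
    (+ d * A x r - levelSum r x (λ _ u → parentTerm c u)) - A x (1 + r)
      ∎
    where open ≡-Reasoning

  Δ : ℕ → ℤ
  Δ r = A j r - A (sibling j) r

  initial : + k ≡ + d * Δ 0 - Δ 1
  initial = subtract-balances {z = + d} {A j 0} {A (sibling j) 0} {parentTerm c j} {A j 1} {A (sibling j) 1}
    (trans (sym (scaledBasis-self k j)) (level-balance j 0 z≤n))
    (begin
      + 0                                                     ≡⟨ cong (λ b → if b then + k else + 0) (eqVtx-sibling j) ⟨
      scaledBasis k j (suc n′) (sibling j)                    ≡⟨ level-balance (sibling j) 0 z≤n ⟩
      (+ d * A (sibling j) 0 - parentTerm c (sibling j)) - A (sibling j) 1
                                                              ≡⟨ cong (λ p → (+ d * A (sibling j) 0 - p) - A (sibling j) 1)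
                                                                      (parentTerm-sibling c j) ⟩
      (+ d * A (sibling j) 0 - parentTerm c j) - A (sibling j) 1 ∎)
    where
    open ≡-Reasoning
    subtract-balances : ∀ {k} {z a a′ p y y′} →
      k ≡ (z * a - p) - y → + 0 ≡ (z * a′ - p) - y′ → k ≡ z * (a - a′) - (y - y′)
    subtract-balances {k} {z} {a} {a′} {p} {y} {y′} eq eq′ =
      trans (sym (ℤ.+-identityʳ k)) (trans (cong₂ _-_ eq eq′) (identity z a a′ p y y′))
      where
      identity : ∀ z a a′ p y y′ → ((z * a - p) - y) - ((z * a′ - p) - y′) ≡ z * (a - a′) - (y - y′)
      identity = solve-∀

  level-balance-inner : ∀ x r → r < H → + 0 ≡ (+ d * A x (1 + r) - + D * A x r) - A x (2 + r)
  level-balance-inner x r r<H = begin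
    + 0
      ≡⟨ levelSum-vanishing (suc r) x _ (λ where m refl u → scaledBasis-depth≢ k j u (ℕ.m≢1+n+m (suc n′))) ⟨
    levelSum (1 + r) x (scaledBasis k j)
      ≡⟨ level-balance x (1 + r) r<H ⟩
    (+ d * A x (1 + r) - levelSum (1 + r) x (λ _ u → parentTerm c u)) - A x (2 + r)
      ≡⟨ cong (λ p → (+ d * A x (1 + r) - p) - A x (2 + r))
              (trans (levelSum-parentTerm r x c) (cong (+ D *_) (sym (A-below x (ℕ.<⇒≤ r<H))))) ⟩
    (+ d * A x (1 + r) - + D * A x r) - A x (2 + r)
      ∎
    where open ≡-Reasoning

  step : ∀ r → r < H → + 0 ≡ + d * Δ (1 + r) - + D * Δ r - Δ (2 + r)
  step r r<H = trans (cong₂ _-_ (level-balance-inner j r r<H) (level-balance-inner (sibling j) r r<H))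
                     (identity (+ d) (+ D) (A j (1 + r)) (A (sibling j) (1 + r)) (A j r) (A (sibling j) r)
                               (A j (2 + r)) (A (sibling j) (2 + r)))
    where
    identity : ∀ z b a a′ q q′ y y′ →
      ((z * a - b * q) - y) - ((z * a′ - b * q′) - y′) ≡ z * (a - a′) - b * (q - q′) - (y - y′)
    identity = solve-∀

  terminal : Δ (1 + H) ≡ + 0
  terminal = cong₂ _-_ (A-beyond j) (A-beyond (sibling j))

  repunit-divides : repunit D (2 + H) ∣ k
  repunit-divides = ∣⇒∣ᵤ (divides (+ k - + D * Δ 0)
    (trans (solution-of-recurrence D H (+ k) Δ initial step terminal)
           (ℤ.*-comm (+ repunit D (2 + H)) (+ k - + D * Δ 0))))

order-divides : ∀ e {h n′} (j : Vtx (3 + e) (suc n′)) → suc n′ ≤ h →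
  ∀ k → InSubgroupBelow (3 + e) h (suc n′) (scaledBasis k j) → repunit (2 + e) (2 + (h ∸ suc n′)) ∣ k
order-divides e j n≤h k (c , err , err-vanishes , balance) =
  LowerBound.repunit-divides e j n≤h k c err err-vanishes balance

proposition8p10 : (d h n : ℕ) → 3 ≤ d → 1 ≤ h → 1 ≤ n → n ≤ h →
    (j : Vtx d n) → HasOrderInQuotient d h n j (θ d (h + 2 ∸ n))
proposition8p10 (suc (suc (suc e))) h (suc n′) _ _ _ n≤h j rewrite θ-at-depth e n≤h =
  HasOrderInQuotient-intro {j = j} (repunit-suc-positive (2 + e) (1 + (h ∸ suc n′)))
    (UpperBound.multiple-in-subgroup e j n≤h)
    (order-divides e j n≤h)
proposition8p10 (suc (suc zero)) _ _ (s≤s (s≤s ())) _ _ _ _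
proposition8p10 (suc zero)       _ _ (s≤s ())       _ _ _ _
proposition8p10 zero             _ _ ()             _ _ _ _
proposition8p10 (suc (suc (suc e))) h zero _ _ () _ _
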